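{- Let $m\geq0$ and $n\geq1$ be integers. For $c=(c_{ij})\in\mathcal{C}_{n,m}$ define $b=(b_{ij})_{1\leq i\leq j\leq n+m-1}$ by \[ n-b_{ij}=\#\{l:\ c_{n+m-j,\,l}\geq 1-i+j\}\qquad(1\leq i\leq j\leq n+m-1). \] Then $b\in\mathcal{T}_{n,m}$, and the map $\Phi_{n,m}:c\mapsto b$ is a bijection of $\mathcal{C}_{n,m}$ onto $\mathcal{T}_{n,m}$.
   Context: $\mathcal{C}_{n,m}$ is the set of plane partitions $c=(c_{ij})_{i,j\geq1}$ (arrays of nonnegative integers with finitely many nonzero entries, weakly decreasing along rows and columns) with at most $n$ nonzero columns, nonzero entries strictly decreasing down each column, and each nonzero entry in column $j$ at most $n+m-j$. $\mathcal{T}_{n,m}$ is the set of arrays $b=(b_{ij})_{1\leq i\leq j\leq n+m-1}$ of integers weakly decreasing along rows and columns with $\max\{n-i,0\}\leq b_{ij}\leq n$. -}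

module Defs where

open import Data.Nat using (ℕ; zero; suc; _+_; _∸_; _≤_; _<_; _≤?_)
open import Data.Fin using (Fin; toℕ; opposite)
open import Data.Vec using (Vec; lookup; tabulate; count)

-- Conventions (0-based Fin indices; paper index = Fin index + 1).
-- N = n + m - 1 is the number of rows of c (and the size of b).
size : ℕ → ℕ → ℕ
size n m = n + m ∸ 1

-- A plane partition in C_{n,m}, restricted to rows 1..n+m-1 and columns 1..n
-- (all other entries are forced to be 0).
CArr : ℕ → ℕ → Set
CArr n m = Vec (Vec ℕ n) (size n m)

-- b = (b_ij), stored as a square array; only entries with i ≤ j are meaningful.
TArr : ℕ → ℕ → Set
TArr n m = Vec (Vec ℕ (size n m)) (size n m)

at : ∀ {A : Set} {r k} → Vec (Vec A k) r → Fin r → Fin k → A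
at a i j = lookup (lookup a i) j

record IsC (n m : ℕ) (c : CArr n m) : Set where
  field
    rowDec   : ∀ r (l l' : Fin n) → toℕ l ≤ toℕ l' → (at c r l') ≤ (at c r l)
    colDec   : ∀ (r r' : Fin (size n m)) l → toℕ r ≤ toℕ r' → (at c r' l) ≤ (at c r l)
    colStrict : ∀ (r r' : Fin (size n m)) l → toℕ r < toℕ r' → 1 ≤ (at c r' l) →
                (at c r' l) < (at c r l)
    bound    : ∀ r (l : Fin n) → (at c r l) ≤ n + m ∸ suc (toℕ l)

record IsT (n m : ℕ) (b : TArr n m) : Set where
  field
    rowDec : ∀ (i j j' : Fin (size n m)) → toℕ i ≤ toℕ j → toℕ j ≤ toℕ j' →
             (at b i j') ≤ (at b i j)
    colDec : ∀ (i i' j : Fin (size n m)) → toℕ i ≤ toℕ i' → toℕ i' ≤ toℕ j →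
             (at b i' j) ≤ (at b i j)
    lower  : ∀ (i j : Fin (size n m)) → toℕ i ≤ toℕ j → n ∸ suc (toℕ i) ≤ (at b i j)
    upper  : ∀ (i j : Fin (size n m)) → toℕ i ≤ toℕ j → (at b i j) ≤ n

EqT : (n m : ℕ) → TArr n m → TArr n m → Set
EqT n m b b' = ∀ (i j : Fin (size n m)) → toℕ i ≤ toℕ j → (at b i j) ≡ (at b' i j)
  where open import Relation.Binary.PropositionalEquality using (_≡_)

-- Φ_{n,m}: n - b_ij = #{ l : c_{n+m-j, l} ≥ 1 - i + j }.
-- Paper row n+m-j (1-based) = Fin index (size n m - 1 - j₀) = opposite j₀.
-- Threshold 1 - i + j = suc j₀ ∸ i₀ (for i₀ ≤ j₀).
Φ : (n m : ℕ) → CArr n m → TArr n m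
Φ n m c = tabulate λ i → tabulate λ j →
  n ∸ count (λ x → (suc (toℕ j) ∸ toℕ i) ≤? x) (lookup c (opposite j))

-- With N = n + m - 1, the definition of Φ says that row N - 1 - j of c, read as a partition
-- with at most n parts, and the sequence (n - b_{j-s,j})_{0 ≤ s ≤ j} are conjugate partitions.
-- Conjugation inside a box is an involution, so Φ has the explicit inverse Φ⁻¹ which conjugates
-- each column of b back into a row of c; as Φ⁻¹ reads only the entries b_ij with i ≤ j, Φ is
-- injective. The defining inequalities correspond under conjugation: strict decrease down the
-- columns of c becomes weak decrease along the rows of b, and the bound c_{rl} ≤ N - l, which
-- with strictness forces c_{rl} ≤ N - r - l, becomes the lower bound on b (and conversely).

module Submission where

open import Defs
open import Data.Nat
open import Data.Nat.Properties
open import Data.Fin using (Fin; toℕ; fromℕ<; opposite)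
open import Data.Fin.Properties using (toℕ-fromℕ<; toℕ<n; toℕ-injective; opposite-prop)
open import Data.Vec using (Vec; []; _∷_; lookup; tabulate; count)
open import Data.Vec.Properties using (lookup∘tabulate; tabulate∘lookup; tabulate-cong)
open import Data.Product using (Σ; _×_; _,_)
open import Data.Sum using (inj₁; inj₂)
open import Function using (_∘_)
open import Relation.Nullary using (yes; no; contradiction)
open import Relation.Nullary.Decidable using (dec-true; dec-false; decidable-stable)
open import Relation.Binary.PropositionalEquality

variable
  f g : ℕ → ℕ
  a d i i' j j' k l r r' s s' t t' x T : ℕ

Antitone : (ℕ → ℕ) → ℕ → Set
Antitone f k = ∀ {x y} → x ≤ y → y < k → f y ≤ f x

-- conjugate f k t = #{x < k | t ≤ f x}: for a partition f 0 ≥ … ≥ f (k - 1) this is the t-th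
-- part of the conjugate partition. It is opaque so that unification can read f, k and t off it.
opaque
  conjugate : (ℕ → ℕ) → ℕ → ℕ → ℕ
  conjugate f zero    t = 0
  conjugate f (suc k) t with t ≤? f 0
  ... | yes _ = suc (conjugate (f ∘ suc) k t)
  ... | no  _ = conjugate (f ∘ suc) k t

  conjugate-≤ : (∀ x → x < k → t ≤ f x → x < a) → conjugate f k t ≤ a
  conjugate-≤ {k = zero} _ = z≤n
  conjugate-≤ {k = suc k} {t} {f} {a} below with t ≤? f 0 | below 0 z<s
  ... | yes t≤f0 | 0<a with 0<a t≤f0
  ...   | s≤s _ = s≤s (conjugate-≤ λ x x<k t≤fx → s<s⁻¹ (below (suc x) (s<s x<k) t≤fx))
  conjugate-≤ {k = suc k} {t} {f} {a} below | no _ | _ =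
    conjugate-≤ λ x x<k t≤fx → <-trans (n<1+n x) (below (suc x) (s<s x<k) t≤fx)

  conjugate-≥ : (∀ x → x < a → t ≤ f x) → a ≤ k → a ≤ conjugate f k t
  conjugate-≥ {a = zero} _ _ = z≤n
  conjugate-≥ {a = suc a} {t} {f} {suc k} above (s≤s a≤k) with t ≤? f 0
  ... | yes _ = s≤s (conjugate-≥ (λ x x<a → above (suc x) (s<s x<a)) a≤k)
  ... | no t≰f0 = contradiction (above 0 z<s) t≰f0

  conjugate-mono : (∀ x → x < k → t ≤ f x → t' ≤ g x) → conjugate f k t ≤ conjugate g k t'
  conjugate-mono {k = zero} _ = z≤n
  conjugate-mono {k = suc k} {t} {f} {t'} {g} h with t ≤? f 0 | t' ≤? g 0
  ... | yes _     | yes _     = s≤s (conjugate-mono λ x x<k → h (suc x) (s<s x<k))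
  ... | yes t≤f0  | no t'≰g0  = contradiction (h 0 z<s t≤f0) t'≰g0
  ... | no _      | yes _     = m≤n⇒m≤1+n (conjugate-mono λ x x<k → h (suc x) (s<s x<k))
  ... | no _      | no _      = conjugate-mono λ x x<k → h (suc x) (s<s x<k)

conjugate-antitone : t ≤ t' → conjugate f k t' ≤ conjugate f k t
conjugate-antitone t≤t' = conjugate-mono λ _ _ → ≤-trans t≤t'

conjugate-cong : (∀ x → x < k → f x ≡ g x) → conjugate f k t ≡ conjugate g k t
conjugate-cong f≗g = ≤-antisym
  (conjugate-mono λ x x<k t≤fx → ≤-trans t≤fx (≤-reflexive (f≗g x x<k)))
  (conjugate-mono λ x x<k t≤gx → ≤-trans t≤gx (≤-reflexive (sym (f≗g x x<k))))

conjugate-≤-length : conjugate f k t ≤ k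
conjugate-≤-length = conjugate-≤ λ _ x<k _ → x<k

≤⇒<conjugate : Antitone f k → x < k → t ≤ f x → x < conjugate f k t
≤⇒<conjugate antitone x<k t≤fx =
  conjugate-≥ (λ y y<1+x → ≤-trans t≤fx (antitone (s≤s⁻¹ y<1+x) x<k)) x<k

<conjugate⇒≤ : Antitone f k → x < conjugate f k t → t ≤ f x
<conjugate⇒≤ {f} {k} {x} {t} antitone x<conj = decidable-stable (t ≤? f x) λ t≰fx →
  <⇒≱ x<conj (conjugate-≤ λ y y<k t≤fy → decidable-stable (y <? x) λ y≮x →
    t≰fx (≤-trans t≤fy (antitone (≮⇒≥ y≮x) y<k)))

conjugate-involutive : Antitone f k → (∀ x → x < k → f x ≤ T) → x < k →
                       conjugate (λ s → conjugate f k (suc s)) T (suc x) ≡ f x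
conjugate-involutive antitone bounded x<k = ≤-antisym
  (conjugate-≤ λ _ _ x<conj → <conjugate⇒≤ antitone x<conj)
  (conjugate-≥ (λ _ s<fx → ≤⇒<conjugate antitone x<k s<fx) (bounded _ x<k))

-- Arrays are read with ℕ indices (0 out of range) so that index arithmetic stays in ℕ.
_‼_ : ∀ {k} → Vec ℕ k → ℕ → ℕ
[]      ‼ _     = 0
(x ∷ _) ‼ zero  = x
(_ ∷ v) ‼ suc i = v ‼ i

entry : ∀ {r k} → Vec (Vec ℕ k) r → ℕ → ℕ → ℕ
entry []      _       = λ _ → 0
entry (v ∷ _) zero    = v ‼_
entry (_ ∷ a) (suc i) = entry a i

‼-lookup : ∀ {k} (v : Vec ℕ k) (i : Fin k) → v ‼ toℕ i ≡ lookup v i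
‼-lookup (_ ∷ _) Fin.zero    = refl
‼-lookup (_ ∷ v) (Fin.suc i) = ‼-lookup v i

entry-lookup : ∀ {r k} (a : Vec (Vec ℕ k) r) (i : Fin r) j → entry a (toℕ i) j ≡ lookup a i ‼ j
entry-lookup (_ ∷ _) Fin.zero    _ = refl
entry-lookup (_ ∷ a) (Fin.suc i) j = entry-lookup a i j

entry-at : ∀ {r k} (a : Vec (Vec ℕ k) r) i j → entry a (toℕ i) (toℕ j) ≡ at a i j
entry-at a i j = trans (entry-lookup a i (toℕ j)) (‼-lookup (lookup a i) j)

at-tabulate : ∀ {r k} (h : Fin r → Fin k → ℕ) i j → at (tabulate λ i → tabulate (h i)) i j ≡ h i j
at-tabulate h i j = trans (cong (λ v → lookup v j) (lookup∘tabulate _ i)) (lookup∘tabulate (h i) j)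

at-ext : ∀ {r k} {a a' : Vec (Vec ℕ k) r} → (∀ i j → at a i j ≡ at a' i j) → a ≡ a'
at-ext {a = a} {a'} a≗a' = begin
  a                                                ≡⟨ tabulate²∘at a ⟨
  tabulate (λ i → tabulate λ j → at a i j)         ≡⟨ tabulate-cong (λ i → tabulate-cong (a≗a' i)) ⟩
  tabulate (λ i → tabulate λ j → at a' i j)        ≡⟨ tabulate²∘at a' ⟩
  a'                                               ∎
  where
  open ≡-Reasoning
  tabulate²∘at : ∀ {r k} (a : Vec (Vec ℕ k) r) → tabulate (λ i → tabulate λ j → at a i j) ≡ a
  tabulate²∘at a = trans (tabulate-cong λ i → tabulate∘lookup (lookup a i)) (tabulate∘lookup a)

toFin : ∀ {i k} → i < k → Σ (Fin k) λ i' → toℕ i' ≡ i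
toFin i<k = fromℕ< i<k , toℕ-fromℕ< i<k

entry-tabulate : ∀ {r k} (h : ℕ → ℕ → ℕ) → i < r → j < k →
                 entry (tabulate {n = r} λ i → tabulate {n = k} λ j → h (toℕ i) (toℕ j)) i j ≡ h i j
entry-tabulate h i<r j<k with toFin i<r | toFin j<k
... | i , refl | j , refl = trans (entry-at (tabulate λ i → tabulate λ j → h (toℕ i) (toℕ j)) i j)
                                   (at-tabulate (λ i j → h (toℕ i) (toℕ j)) i j)

opaque
  unfolding conjugate

  count-≤?-conjugate : ∀ {k} (v : Vec ℕ k) → count (t ≤?_) v ≡ conjugate (v ‼_) k t
  count-≤?-conjugate [] = refl
  count-≤?-conjugate {t} (x ∷ v) with t ≤? x
  ... | yes t≤x rewrite dec-true (t ≤? x) t≤x = cong suc (count-≤?-conjugate v)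
  ... | no t≰x rewrite dec-false (t ≤? x) t≰x = count-≤?-conjugate v

m∸n≡suc[m∸suc[n]] : ∀ {m n} → n < m → m ∸ n ≡ suc (m ∸ suc n)
m∸n≡suc[m∸suc[n]] = +-∸-assoc 1

m∸suc[n]<m : ∀ {m n} → n < m → m ∸ suc n < m
m∸suc[n]<m {m} {n} n<m = ≤-trans (≤-reflexive (sym (m∸n≡suc[m∸suc[n]] n<m))) (m∸n≤m m n)

m∸suc[m∸suc[n]]≡n : ∀ {m n} → n < m → m ∸ suc (m ∸ suc n) ≡ n
m∸suc[m∸suc[n]]≡n {m} {n} n<m =
  trans (cong (m ∸_) (sym (m∸n≡suc[m∸suc[n]] n<m))) (m∸[m∸n]≡n (<⇒≤ n<m))

m∸suc[n]≡o+[m∸suc[n+o]] : ∀ {m n o} → n + o < m → m ∸ suc n ≡ o + (m ∸ suc (n + o))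
m∸suc[n]≡o+[m∸suc[n+o]] {m} {n} {o} n+o<m = begin
  m ∸ suc n                 ≡⟨ m+[n∸m]≡n o≤m∸suc[n] ⟨
  o + (m ∸ suc n ∸ o)       ≡⟨ cong (o +_) (∸-+-assoc m (suc n) o) ⟩
  o + (m ∸ suc (n + o))     ∎
  where
  open ≡-Reasoning
  o≤m∸suc[n] : o ≤ m ∸ suc n
  o≤m∸suc[n] = m+n≤o⇒m≤o∸n o (≤-trans (≤-reflexive (+-comm o (suc n))) n+o<m)

m∸[m∸n]≤n : ∀ m n → m ∸ (m ∸ n) ≤ n
m∸[m∸n]≤n m n with n ≤? m
... | yes n≤m = ≤-reflexive (m∸[m∸n]≡n n≤m)
... | no n≰m rewrite m≤n⇒m∸n≡0 (<⇒≤ (≰⇒> n≰m)) = <⇒≤ (≰⇒> n≰m)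

0<m∸n⇒n<m : ∀ {m n} → 0 < m ∸ n → n < m
0<m∸n⇒n<m 0<m∸n = m∸n≢0⇒n<m λ m∸n≡0 → <-irrefl (sym m∸n≡0) 0<m∸n

m<n⇒o≤1+p⇒m∸p≤n∸o : ∀ {m n o p} → m < n → o ≤ suc p → m ∸ p ≤ n ∸ o
m<n⇒o≤1+p⇒m∸p≤n∸o {n = suc n} {p = p} (s≤s m≤n) o≤1+p =
  ≤-trans (∸-monoˡ-≤ p m≤n) (∸-monoʳ-≤ (suc n) o≤1+p)

[0<x⇒x≤y]⇒x≤y : ∀ {x y} → (0 < x → x ≤ y) → x ≤ y
[0<x⇒x≤y]⇒x≤y {zero}  _   = z≤n
[0<x⇒x≤y]⇒x≤y {suc x} x≤y = x≤y z<s

module Bijection (n m : ℕ) where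

  private
    N : ℕ
    N = size n m

  conjugateRow : CArr n m → ℕ → ℕ → ℕ
  conjugateRow c j = conjugate (entry c (N ∸ suc j)) n

  Φ-at : (c : CArr n m) (i j : Fin N) →
         at (Φ n m c) i j ≡ n ∸ conjugateRow c (toℕ j) (suc (toℕ j) ∸ toℕ i)
  Φ-at c i j = begin
    at (Φ n m c) i j
      ≡⟨ at-tabulate _ i j ⟩
    n ∸ count (θ ≤?_) (lookup c (opposite j))
      ≡⟨ cong (n ∸_) (count-≤?-conjugate (lookup c (opposite j))) ⟩
    n ∸ conjugate (lookup c (opposite j) ‼_) n θ
      ≡⟨ cong (n ∸_) (conjugate-cong λ l _ → sym (entry-lookup c (opposite j) l)) ⟩
    n ∸ conjugate (entry c (toℕ (opposite j))) n θ
      ≡⟨ cong (λ r → n ∸ conjugate (entry c r) n θ) (opposite-prop j) ⟩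
    n ∸ conjugateRow c (toℕ j) θ
      ∎
    where
    open ≡-Reasoning
    θ : ℕ
    θ = suc (toℕ j) ∸ toℕ i

  Φ-entry : (c : CArr n m) → i < N → j < N → entry (Φ n m c) i j ≡ n ∸ conjugateRow c j (suc j ∸ i)
  Φ-entry c i<N j<N with toFin i<N | toFin j<N
  ... | i , refl | j , refl = trans (entry-at (Φ n m c) i j) (Φ-at c i j)

  coColumn : TArr n m → ℕ → ℕ → ℕ
  coColumn b j s = n ∸ entry b (j ∸ s) j

  conjugateColumn : TArr n m → ℕ → ℕ → ℕ
  conjugateColumn b j = conjugate (coColumn b j) (suc j)

  Φ⁻¹ : TArr n m → CArr n m
  Φ⁻¹ b = tabulate λ r → tabulate λ l → conjugateColumn b (N ∸ suc (toℕ r)) (suc (toℕ l))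

  Φ⁻¹-at : (b : TArr n m) (r : Fin N) (l : Fin n) →
           at (Φ⁻¹ b) r l ≡ conjugateColumn b (N ∸ suc (toℕ r)) (suc (toℕ l))
  Φ⁻¹-at b = at-tabulate _

  Φ⁻¹-row : (b : TArr n m) → j < N → l < n →
            entry (Φ⁻¹ b) (N ∸ suc j) l ≡ conjugateColumn b j (suc l)
  Φ⁻¹-row b j<N l<n =
    trans (entry-tabulate (λ r l → conjugateColumn b (N ∸ suc r) (suc l)) (m∸suc[n]<m j<N) l<n)
          (cong (λ j → conjugateColumn b j (suc _)) (m∸suc[m∸suc[n]]≡n j<N))

  Φ-coColumn : (c : CArr n m) → j < N → s ≤ j → coColumn (Φ n m c) j s ≡ conjugateRow c j (suc s)
  Φ-coColumn {j} {s} c j<N s≤j = begin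
    n ∸ entry (Φ n m c) (j ∸ s) j
      ≡⟨ cong (n ∸_) (Φ-entry c (≤-<-trans (m∸n≤m j s) j<N) j<N) ⟩
    n ∸ (n ∸ conjugateRow c j (suc j ∸ (j ∸ s)))
      ≡⟨ m∸[m∸n]≡n conjugate-≤-length ⟩
    conjugateRow c j (suc j ∸ (j ∸ s))
      ≡⟨ cong (conjugateRow c j) (+-∸-assoc 1 (m∸n≤m j s)) ⟩
    conjugateRow c j (suc (j ∸ (j ∸ s)))
      ≡⟨ cong (conjugateRow c j ∘ suc) (m∸[m∸n]≡n s≤j) ⟩
    conjugateRow c j (suc s)
      ∎
    where open ≡-Reasoning

  module _ {c : CArr n m} (isC : IsC n m c) where
    open IsC isC

    row-antitone : r < N → Antitone (entry c r) n
    row-antitone r<N l≤l' l'<n with toFin r<N | toFin (≤-<-trans l≤l' l'<n) | toFin l'<n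
    ... | r , refl | l , refl | l' , refl =
      subst₂ _≤_ (sym (entry-at c r l')) (sym (entry-at c r l)) (rowDec r l l' l≤l')

    column-strict : r < r' → r' < N → l < n → 0 < entry c r' l → entry c r' l < entry c r l
    column-strict r<r' r'<N l<n 0<c with toFin (<-trans r<r' r'<N) | toFin r'<N | toFin l<n
    ... | r , refl | r' , refl | l , refl =
      subst₂ _<_ (sym (entry-at c r' l)) (sym (entry-at c r l))
        (colStrict r r' l r<r' (subst (0 <_) (entry-at c r' l) 0<c))

    column-gap : d + r < N → l < n → 0 < entry c (d + r) l → entry c (d + r) l + d ≤ entry c r l
    column-gap {zero} _ _ _ = ≤-reflexive (+-identityʳ _)
    column-gap {suc d} {r} {l} 1+d+r<N l<n 0<c = begin
      entry c (suc d + r) l + suc d    ≡⟨ +-suc _ d ⟩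
      suc (entry c (suc d + r) l) + d  ≤⟨ +-monoˡ-≤ d c₁<c₀ ⟩
      entry c (d + r) l + d            ≤⟨ column-gap (<-trans (n<1+n _) 1+d+r<N) l<n (<-trans 0<c c₁<c₀) ⟩
      entry c r l                      ∎
      where
      open ≤-Reasoning
      c₁<c₀ : entry c (suc d + r) l < entry c (d + r) l
      c₁<c₀ = column-strict (n<1+n _) 1+d+r<N l<n 0<c

    entry-bound : r < N → l < n → entry c r l ≤ N ∸ l
    entry-bound r<N l<n with toFin r<N | toFin l<n
    ... | r , refl | l , refl =
      subst₂ _≤_ (sym (entry-at c r l)) (sym (∸-+-assoc (n + m) 1 (toℕ l))) (bound r l)

    entry-height : r < N → l < n → entry c r l ≤ N ∸ r ∸ l
    entry-height {r} {l} r<N l<n = [0<x⇒x≤y]⇒x≤y λ 0<c → begin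
      entry c r l          ≤⟨ m+n≤o⇒m≤o∸n _ (≤-trans (gap 0<c) (entry-bound 0<N l<n)) ⟩
      N ∸ l ∸ r            ≡⟨ ∸-+-assoc N l r ⟩
      N ∸ (l + r)          ≡⟨ cong (N ∸_) (+-comm l r) ⟩
      N ∸ (r + l)          ≡⟨ ∸-+-assoc N r l ⟨
      N ∸ r ∸ l            ∎
      where
      open ≤-Reasoning
      0<N : 0 < N
      0<N = ≤-<-trans z≤n r<N
      gap : 0 < entry c r l → entry c r l + r ≤ entry c 0 l
      gap = subst (λ ρ → ρ < N → 0 < entry c ρ l → entry c ρ l + r ≤ entry c 0 l) (+-identityʳ r)
                  (λ r<N → column-gap r<N l<n) r<N

    conjugateRow-shift : i ≤ j → j ≤ j' → j' < N →
                         conjugateRow c j (suc j ∸ i) ≤ conjugateRow c j' (suc j' ∸ i)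
    conjugateRow-shift {i} {j} i≤j j≤j' j'<N with m≤n⇒∃[o]m+o≡n j≤j'
    ... | d , refl = conjugate-mono shift
      where
      r₀ : ℕ
      r₀ = N ∸ suc (j + d)
      rows : N ∸ suc j ≡ d + r₀
      rows = m∸suc[n]≡o+[m∸suc[n+o]] j'<N
      shift : ∀ x → x < n → suc j ∸ i ≤ entry c (N ∸ suc j) x → suc (j + d) ∸ i ≤ entry c r₀ x
      shift x x<n θ≤c = begin
        suc j + d ∸ i           ≡⟨ +-∸-comm d (m≤n⇒m≤1+n i≤j) ⟩
        suc j ∸ i + d           ≤⟨ +-monoˡ-≤ d θ≤c' ⟩
        entry c (d + r₀) x + d  ≤⟨ column-gap d+r₀<N x<n (<-≤-trans (m<n⇒0<n∸m (s≤s i≤j)) θ≤c') ⟩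
        entry c r₀ x            ∎
        where
        open ≤-Reasoning
        θ≤c' : suc j ∸ i ≤ entry c (d + r₀) x
        θ≤c' = subst (λ r → suc j ∸ i ≤ entry c r x) rows θ≤c
        d+r₀<N : d + r₀ < N
        d+r₀<N = subst (_< N) rows (m∸suc[n]<m (≤-<-trans (m≤m+n j d) j'<N))

    conjugateRow-≤ : i ≤ j → j < N → conjugateRow c j (suc j ∸ i) ≤ suc i
    conjugateRow-≤ {i} {j} i≤j j<N = conjugate-≤ λ x x<n θ≤c →
      let θ≤ : suc j ∸ i ≤ suc j ∸ x
          θ≤ = ≤-trans θ≤c (≤-trans (entry-height (m∸suc[n]<m j<N) x<n)
                                   (≤-reflexive (cong (_∸ x) (m∸[m∸n]≡n j<N))))
      in s≤s (∸-cancelʳ-≤ (<⇒≤ (0<m∸n⇒n<m (<-≤-trans (m<n⇒0<n∸m (s≤s i≤j)) θ≤))) θ≤)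

    Φ-isT : IsT n m (Φ n m c)
    Φ-isT = record
      { rowDec = λ i j j' i≤j j≤j' → subst₂ _≤_ (sym (Φ-at c i j')) (sym (Φ-at c i j))
                   (∸-monoʳ-≤ n (conjugateRow-shift i≤j j≤j' (toℕ<n j')))
      ; colDec = λ i i' j i≤i' _ → subst₂ _≤_ (sym (Φ-at c i' j)) (sym (Φ-at c i j))
                   (∸-monoʳ-≤ n (conjugate-antitone (∸-monoʳ-≤ (suc (toℕ j)) i≤i')))
      ; lower  = λ i j i≤j → subst (n ∸ suc (toℕ i) ≤_) (sym (Φ-at c i j))
                   (∸-monoʳ-≤ n (conjugateRow-≤ i≤j (toℕ<n j)))
      ; upper  = λ i j _ → subst (_≤ n) (sym (Φ-at c i j))
                   (m∸n≤m n (conjugateRow c (toℕ j) (suc (toℕ j) ∸ toℕ i)))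
      }

    conjugateColumn-Φ : r < N → l < n → conjugateColumn (Φ n m c) (N ∸ suc r) (suc l) ≡ entry c r l
    conjugateColumn-Φ {r} {l} r<N l<n = begin
      conjugateColumn (Φ n m c) (N ∸ suc r) (suc l)
        ≡⟨ conjugate-cong (λ s s<1+j → Φ-coColumn c (m∸suc[n]<m r<N) (s≤s⁻¹ s<1+j)) ⟩
      conjugate (λ s → conjugateRow c (N ∸ suc r) (suc s)) (suc (N ∸ suc r)) (suc l)
        ≡⟨ cong (λ r' → conjugate (λ s → conjugate (entry c r') n (suc s)) (suc (N ∸ suc r)) (suc l))
                (m∸suc[m∸suc[n]]≡n r<N) ⟩
      conjugate (λ s → conjugate (entry c r) n (suc s)) (suc (N ∸ suc r)) (suc l)
        ≡⟨ conjugate-involutive (row-antitone r<N) height l<n ⟩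
      entry c r l
        ∎
      where
      open ≡-Reasoning
      height : ∀ x → x < n → entry c r x ≤ suc (N ∸ suc r)
      height x x<n = ≤-trans (entry-height r<N x<n)
                             (≤-trans (m∸n≤m _ x) (≤-reflexive (m∸n≡suc[m∸suc[n]] r<N)))

    Φ⁻¹∘Φ : Φ⁻¹ (Φ n m c) ≡ c
    Φ⁻¹∘Φ = at-ext λ r l →
      trans (at-tabulate _ r l) (trans (conjugateColumn-Φ (toℕ<n r) (toℕ<n l)) (entry-at c r l))

  conjugateColumn-cong : {b b' : TArr n m} → EqT n m b b' → j < N →
                         conjugateColumn b j t ≡ conjugateColumn b' j t
  conjugateColumn-cong {j = j} {b = b} {b'} b≗b' j<N =
    conjugate-cong λ s _ → cong (n ∸_) (same (m∸n≤m j s))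
    where
    same : i ≤ j → entry b i j ≡ entry b' i j
    same i≤j with toFin (≤-<-trans i≤j j<N) | toFin j<N
    ... | i , refl | j , refl = trans (entry-at b i j) (trans (b≗b' i j i≤j) (sym (entry-at b' i j)))

  Φ⁻¹-cong : {b b' : TArr n m} → EqT n m b b' → Φ⁻¹ b ≡ Φ⁻¹ b'
  Φ⁻¹-cong {b} {b'} b≗b' = at-ext λ r l → trans (Φ⁻¹-at b r l)
    (trans (conjugateColumn-cong {b = b} {b'} b≗b' (m∸suc[n]<m (toℕ<n r))) (sym (Φ⁻¹-at b' r l)))

  module _ {b : TArr n m} (isT : IsT n m b) where
    open IsT isT

    triangle-antitone : i ≤ i' → j ≤ j' → i ≤ j → i' ≤ j' → j' < N → entry b i' j' ≤ entry b i j
    triangle-antitone i≤i' j≤j' i≤j i'≤j' j'<N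
      with toFin (≤-<-trans i≤j (≤-<-trans j≤j' j'<N)) | toFin (≤-<-trans i'≤j' j'<N)
         | toFin (≤-<-trans j≤j' j'<N) | toFin j'<N
    ... | i , refl | i' , refl | j , refl | j' , refl =
      subst₂ _≤_ (sym (entry-at b i' j')) (sym (entry-at b i j))
        (≤-trans (colDec i i' j' i≤i' i'≤j') (rowDec i j j' i≤j j≤j'))

    triangle-lower : i ≤ j → j < N → n ∸ suc i ≤ entry b i j
    triangle-lower i≤j j<N with toFin (≤-<-trans i≤j j<N) | toFin j<N
    ... | i , refl | j , refl = subst (n ∸ suc (toℕ i) ≤_) (sym (entry-at b i j)) (lower i j i≤j)

    triangle-upper : i ≤ j → j < N → entry b i j ≤ n
    triangle-upper i≤j j<N with toFin (≤-<-trans i≤j j<N) | toFin j<N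
    ... | i , refl | j , refl = subst (_≤ n) (sym (entry-at b i j)) (upper i j i≤j)

    coColumn-antitone : j < N → Antitone (coColumn b j) (suc j)
    coColumn-antitone {j} j<N {s} {s'} s≤s' _ =
      ∸-monoʳ-≤ n (triangle-antitone (∸-monoʳ-≤ j s≤s') ≤-refl (m∸n≤m j s') (m∸n≤m j s) j<N)

    coColumn-≤ : j < N → coColumn b j s ≤ suc (j ∸ s)
    coColumn-≤ {j} {s} j<N =
      ≤-trans (∸-monoʳ-≤ n (triangle-lower (m∸n≤m j s) j<N)) (m∸[m∸n]≤n n (suc (j ∸ s)))

    coColumn-shift : j' < j → j < N → s ≤ suc s' → coColumn b j' s' ≤ coColumn b j s
    coColumn-shift {j'} {j} {s} {s'} j'<j j<N s≤1+s' = ∸-monoʳ-≤ n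
      (triangle-antitone (m<n⇒o≤1+p⇒m∸p≤n∸o j'<j s≤1+s') (<⇒≤ j'<j) (m∸n≤m j' s') (m∸n≤m j s) j<N)

    conjugateColumn-≤ : j < N → conjugateColumn b j (suc l) ≤ suc j ∸ l
    conjugateColumn-≤ {j} {l} j<N = conjugate-≤ λ s s<1+j 1+l≤μ →
      let l+s≤j : l + s ≤ j
          l+s≤j = m≤o∸n⇒m+n≤o l (s≤s⁻¹ s<1+j) (s≤s⁻¹ (≤-trans 1+l≤μ (coColumn-≤ {s = s} j<N)))
      in m+n≤o⇒m≤o∸n (suc s) (s≤s (subst (_≤ j) (+-comm l s) l+s≤j))

    conjugateColumn-strict : j' < j → j < N → 0 < conjugateColumn b j' t →
                             conjugateColumn b j' t < conjugateColumn b j t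
    conjugateColumn-strict {j'} {j} {t} j'<j j<N 0<a with conjugateColumn b j' t in eq
    ... | suc a =
      conjugate-≥ (λ s s<2+a → ≤-trans t≤μ'a (coColumn-shift j'<j j<N (s≤s⁻¹ s<2+a))) (s≤s 1+a≤j)
      where
      t≤μ'a : t ≤ coColumn b j' a
      t≤μ'a = <conjugate⇒≤ (coColumn-antitone (<-trans j'<j j<N)) (≤-reflexive (sym eq))
      1+a≤j : suc a ≤ j
      1+a≤j = ≤-trans (subst (_≤ suc j') eq conjugate-≤-length) j'<j

    Φ⁻¹-isC : IsC n m (Φ⁻¹ b)
    Φ⁻¹-isC = record
      { rowDec    = decreasing-along-rows
      ; colDec    = decreasing-down-columns
      ; colStrict = strictly-decreasing-down-columns
      ; bound     = bounded
      }
      where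
      decreasing-along-rows : ∀ r (l l' : Fin n) → toℕ l ≤ toℕ l' → at (Φ⁻¹ b) r l' ≤ at (Φ⁻¹ b) r l
      decreasing-along-rows r l l' l≤l' = subst₂ _≤_ (sym (Φ⁻¹-at b r l')) (sym (Φ⁻¹-at b r l))
        (conjugate-antitone (s≤s l≤l'))

      strictly-decreasing-down-columns : ∀ (r r' : Fin N) l → toℕ r < toℕ r' →
                                         0 < at (Φ⁻¹ b) r' l → at (Φ⁻¹ b) r' l < at (Φ⁻¹ b) r l
      strictly-decreasing-down-columns r r' l r<r' 0<c =
        subst₂ _<_ (sym (Φ⁻¹-at b r' l)) (sym (Φ⁻¹-at b r l))
          (conjugateColumn-strict (∸-monoʳ-< (s≤s r<r') (toℕ<n r')) (m∸suc[n]<m (toℕ<n r))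
            (subst (0 <_) (Φ⁻¹-at b r' l) 0<c))

      decreasing-down-columns : ∀ (r r' : Fin N) l → toℕ r ≤ toℕ r' →
                                at (Φ⁻¹ b) r' l ≤ at (Φ⁻¹ b) r l
      decreasing-down-columns r r' l r≤r' with m≤n⇒m<n∨m≡n r≤r'
      ... | inj₁ r<r' = [0<x⇒x≤y]⇒x≤y λ 0<c → <⇒≤ (strictly-decreasing-down-columns r r' l r<r' 0<c)
      ... | inj₂ r≡r' = ≤-reflexive (cong (λ r → at (Φ⁻¹ b) r l) (toℕ-injective (sym r≡r')))

      bounded : ∀ r (l : Fin n) → at (Φ⁻¹ b) r l ≤ n + m ∸ suc (toℕ l)
      bounded r l = subst₂ _≤_ (sym (Φ⁻¹-at b r l)) (∸-+-assoc (n + m) 1 (toℕ l))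
        (≤-trans (conjugateColumn-≤ j<N) (∸-monoˡ-≤ (toℕ l) j<N))
        where
        j<N : N ∸ suc (toℕ r) < N
        j<N = m∸suc[n]<m (toℕ<n r)

    conjugateRow-Φ⁻¹ : i ≤ j → j < N → n ∸ conjugateRow (Φ⁻¹ b) j (suc j ∸ i) ≡ entry b i j
    conjugateRow-Φ⁻¹ {i} {j} i≤j j<N = begin
      n ∸ conjugateRow (Φ⁻¹ b) j (suc j ∸ i)
        ≡⟨ cong (n ∸_) (conjugate-cong λ l l<n → Φ⁻¹-row b j<N l<n) ⟩
      n ∸ conjugate (λ l → conjugateColumn b j (suc l)) n (suc j ∸ i)
        ≡⟨ cong (λ θ → n ∸ conjugate (λ l → conjugateColumn b j (suc l)) n θ) (+-∸-assoc 1 i≤j) ⟩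
      n ∸ conjugate (λ l → conjugateColumn b j (suc l)) n (suc (j ∸ i))
        ≡⟨ cong (n ∸_) (conjugate-involutive (coColumn-antitone j<N) (λ s _ → m∸n≤m n (entry b (j ∸ s) j))
                                             (s≤s (m∸n≤m j i))) ⟩
      n ∸ (n ∸ entry b (j ∸ (j ∸ i)) j)
        ≡⟨ cong (λ i → n ∸ (n ∸ entry b i j)) (m∸[m∸n]≡n i≤j) ⟩
      n ∸ (n ∸ entry b i j)
        ≡⟨ m∸[m∸n]≡n (triangle-upper i≤j j<N) ⟩
      entry b i j
        ∎
      where open ≡-Reasoning

    Φ∘Φ⁻¹ : EqT n m (Φ n m (Φ⁻¹ b)) b
    Φ∘Φ⁻¹ i j i≤j =
      trans (Φ-at (Φ⁻¹ b) i j) (trans (conjugateRow-Φ⁻¹ i≤j (toℕ<n j)) (entry-at b i j))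

  Φ-injective : {c c' : CArr n m} → IsC n m c → IsC n m c' → EqT n m (Φ n m c) (Φ n m c') → c ≡ c'
  Φ-injective {c} {c'} isC isC' Φc≗Φc' = begin
    c                ≡⟨ Φ⁻¹∘Φ isC ⟨
    Φ⁻¹ (Φ n m c)    ≡⟨ Φ⁻¹-cong {Φ n m c} {Φ n m c'} Φc≗Φc' ⟩
    Φ⁻¹ (Φ n m c')   ≡⟨ Φ⁻¹∘Φ isC' ⟩
    c'               ∎
    where open ≡-Reasoning

corollary3p6 : (m n : ℕ) → 1 ≤ n →
    ((c : CArr n m) → IsC n m c → IsT n m (Φ n m c))
    × ((c c' : CArr n m) → IsC n m c → IsC n m c' → EqT n m (Φ n m c) (Φ n m c') → c ≡ c')
    × ((b : TArr n m) → IsT n m b → Σ (CArr n m) λ c → IsC n m c × EqT n m (Φ n m c) b)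
corollary3p6 m n _ =
    (λ _ → Φ-isT)
  , (λ _ _ → Φ-injective)
  , (λ b isT → Φ⁻¹ b , Φ⁻¹-isC isT , Φ∘Φ⁻¹ isT)
  where open Bijection n m
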